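{- The forest dimension of a digraph is no less than its number of weak components, and does not exceed its number of strong components nor its number of unilateral components.
   Context: For a finite loopless digraph $\Gamma$: a diverging forest is a digraph without circuits with all indegrees $\le1$, its roots being the indegree-0 vertices; a maximum out forest is a spanning diverging forest of $\Gamma$ with the maximum number of arcs; the forest dimension is its number of roots. Weak components are the restrictions of $\Gamma$ to the classes of the relation "connected by a semipath"; strong components are the restrictions to the classes of mutual reachability. A subgraph is unilaterally connected if for any two of its vertices at least one is reachable from the other; unilateral components are the maximal (by inclusion of vertex sets) unilaterally connected subgraphs (they may overlap). -}

module Defs where

open import Data.Nat using (ℕ; zero; suc; _+_; _≤_)
open import Data.Bool using (Bool; true; false; _∨_)
open import Data.Fin using (Fin; zero; suc)
open import Data.Fin.Subset as Sub using (Subset; _∈_; _⊆_; Nonempty)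
open import Data.Product using (Σ; _×_; _,_)
open import Data.Sum using (_⊎_)
open import Data.Empty using (⊥)
open import Data.List using (List; length)
open import Data.List.Relation.Unary.Unique.Propositional using (Unique)
import Data.List.Membership.Propositional as ListMem
open import Relation.Nullary using (¬_)
open import Relation.Binary.PropositionalEquality using (_≡_)
open import Relation.Binary.Construct.Closure.ReflexiveTransitive using (Star)
open import Relation.Binary.Construct.Closure.Transitive using (TransClosure)
open import Relation.Binary.Construct.Closure.Symmetric using (SymClosure)
open import Function.Bundles using (_⇔_)
open import Function.Definitions using (Surjective)

-- A finite digraph on vertex set Fin n, given by its arc relation
-- (G i j ≡ true  iff there is an arc i → j).
Digraph : ℕ → Set
Digraph n = Fin n → Fin n → Bool

Loopless : ∀ {n} → Digraph n → Set
Loopless {n} G = (i : Fin n) → G i i ≡ false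

Arc : ∀ {n} → Digraph n → Fin n → Fin n → Set
Arc G i j = G i j ≡ true

countFin : ∀ {n} → (Fin n → Bool) → ℕ
countFin {zero} p = 0
countFin {suc n} p = (if p zero then 1 else 0) + countFin (λ i → p (suc i))
  where open import Data.Bool using (if_then_else_)

sumFin : ∀ {n} → (Fin n → ℕ) → ℕ
sumFin {zero} f = 0
sumFin {suc n} f = f zero + sumFin (λ i → f (suc i))

anyFin : ∀ {n} → (Fin n → Bool) → Bool
anyFin {zero} p = false
anyFin {suc n} p = p zero ∨ anyFin (λ i → p (suc i))

numArcs : ∀ {n} → Digraph n → ℕ
numArcs G = sumFin (λ i → countFin (G i))

numRoots : ∀ {n} → Digraph n → ℕ
numRoots G = countFin (λ j → Data.Bool.not (anyFin (λ i → G i j)))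
  where import Data.Bool

SubgraphOf : ∀ {n} → Digraph n → Digraph n → Set
SubgraphOf {n} F G = (i j : Fin n) → Arc F i j → Arc G i j

IsSpanningDivergingForest : ∀ {n} → Digraph n → Digraph n → Set
IsSpanningDivergingForest {n} G F =
  SubgraphOf F G
  × ((i : Fin n) → ¬ TransClosure (Arc F) i i)
  × ((i i′ j : Fin n) → Arc F i j → Arc F i′ j → i ≡ i′)

IsMaximumOutForest : ∀ {n} → Digraph n → Digraph n → Set
IsMaximumOutForest G F =
  IsSpanningDivergingForest G F
  × (∀ F′ → IsSpanningDivergingForest G F′ → numArcs F′ ≤ numArcs F)

Reach : ∀ {n} → Digraph n → Fin n → Fin n → Set
Reach G = Star (Arc G)

WeaklyConnected : ∀ {n} → Digraph n → Fin n → Fin n → Set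
WeaklyConnected G = Star (SymClosure (Arc G))

StronglyConnected : ∀ {n} → Digraph n → Fin n → Fin n → Set
StronglyConnected G i j = Reach G i j × Reach G j i

NumClasses : ∀ {n} → (Fin n → Fin n → Set) → ℕ → Set
NumClasses {n} R k =
  Σ (Fin n → Fin k) λ c → Surjective _≡_ _≡_ c × ((i j : Fin n) → (c i ≡ c j) ⇔ R i j)

InducedArc : ∀ {n} → Digraph n → Subset n → Fin n → Fin n → Set
InducedArc G S i j = Arc G i j × i ∈ S × j ∈ S

ReachIn : ∀ {n} → Digraph n → Subset n → Fin n → Fin n → Set
ReachIn G S = Star (InducedArc G S)

UnilaterallyConnected : ∀ {n} → Digraph n → Subset n → Set
UnilaterallyConnected {n} G S =
  (i j : Fin n) → i ∈ S → j ∈ S → ReachIn G S i j ⊎ ReachIn G S j i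

IsUnilateralComponent : ∀ {n} → Digraph n → Subset n → Set
IsUnilateralComponent {n} G S =
  Nonempty S × UnilaterallyConnected G S
  × ((T : Subset n) → S ⊆ T → UnilaterallyConnected G T → T ≡ S)

NumUnilateralComponents : ∀ {n} → Digraph n → ℕ → Set
NumUnilateralComponents {n} G k =
  Σ (List (Subset n)) λ L →
    Unique L
    × ((S : Subset n) → (S ListMem.∈ L) ⇔ IsUnilateralComponent G S)
    × length L ≡ k

{-# OPTIONS --safe #-}
-- Key fact: a G-path from a root r′ of a maximum out forest F to a different root r cannot exist.
-- Follow such a path to its first arc x → z entering the F-tree of r and make x the parent of z.
-- If z is a root (z = r), this gives a diverging forest with one more arc. Otherwise the number
-- of arcs is unchanged, so the new forest is again maximum, z has left the tree of r, and the
-- argument continues from z along a shorter path. Hence distinct roots lie in distinct strong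
-- classes and in distinct unilateral components. Conversely, every vertex descends from a root
-- of the acyclic forest F, so every weak class contains a root.
-- All conclusions are decidable, so the argument may reason classically in the ¬¬-monad.
module Submission where

open import Defs
open import Level using (0ℓ)
open import Data.Bool using (Bool; true; false; not; if_then_else_)
import Data.Bool as Bool
open import Data.Bool.Properties using (¬-not)
open import Data.Empty using (⊥-elim)
open import Data.Fin using (Fin; zero; suc; punchIn; _≟_)
open import Data.Fin.Properties using (∀-cons; punchInᵢ≢i; injective⇒≤; any?; suc-injective)
open import Data.Fin.Subset using (Subset; _∈_; _⊆_; _⊂_; _⊃_; ⁅_⁆)
open import Data.Fin.Subset.Induction using (⊂-wellFounded; ⊃-wellFounded)
open import Data.Fin.Subset.Properties using (_∈?_; ⊆-refl; ⊆-trans; ⊆-antisym; x∈⁅x⁆; x∈⁅y⁆⇒x≡y)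
open import Data.List using (length)
open import Data.List.Membership.Propositional using () renaming (_∈_ to _∈L_)
open import Data.List.Membership.Setoid.Properties using (index-injective)
import Data.List.Relation.Unary.Any as Any
open import Data.Nat using (ℕ; zero; suc; _+_; _≤_; _<_; _≤?_)
open import Data.Nat.Properties
  using (+-0-commutativeMonoid; +-commutativeSemigroup; +-comm; +-identityʳ; +-cancelʳ-≡; ≤-reflexive; ≤-trans; <⇒≱)
import Data.Product as Product
open import Data.Product using (Σ; ∃; _×_; _,_; proj₁; proj₂; uncurry)
open import Data.Sum using (_⊎_; inj₁; inj₂)
open import Data.Vec using ([]; _∷_; here; there)
open import Effect.Monad using (RawMonad)
open import Function.Base using (id; _∘_; case_of_)
open import Function.Bundles using (_⇔_; mk⇔; Equivalence)
open import Function.Definitions using (Injective)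
open import Induction.WellFounded using (Acc; acc)
open import Relation.Binary.Core using (Rel)
open import Relation.Binary.Construct.Closure.ReflexiveTransitive as Star using (Star; ε; _◅_; _◅◅_)
open import Relation.Binary.Construct.Closure.Symmetric using (fwd)
open import Relation.Binary.Construct.Closure.Transitive using (TransClosure; [_]; _∷_; _∷ʳ_)
import Relation.Binary.PropositionalEquality as ≡
open import Relation.Binary.PropositionalEquality
  using (_≡_; _≢_; refl; sym; trans; cong; cong₂; subst; module ≡-Reasoning)
open import Relation.Nullary using (¬_; Dec; yes; no; does)
open import Relation.Nullary.Decidable using (decidable-stable; ¬¬-excluded-middle; dec-true; dec-false)
open import Relation.Nullary.Negation using (¬¬-Monad; contradiction)
open import Relation.Unary using (Pred)

open import Algebra.Properties.CommutativeMonoid.Sum +-0-commutativeMonoid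
  using (sum-syntax; sum-remove; sum-cong-≗; ∑-comm)
open import Algebra.Properties.CommutativeSemigroup +-commutativeSemigroup using (xy∙z≈zy∙x)
open RawMonad (¬¬-Monad {0ℓ})
open ≡-Reasoning

¬¬-Π : ∀ {n} {P : Pred (Fin n) 0ℓ} → (∀ i → ¬ ¬ P i) → ¬ ¬ (∀ i → P i)
¬¬-Π {zero}  _   = pure λ ()
¬¬-Π {suc n} ¬¬P = ∀-cons <$> ¬¬P zero ⊛ ¬¬-Π (¬¬P ∘ suc)

¬¬-subset : ∀ {n} (P : Pred (Fin n) 0ℓ) → ¬ ¬ Σ (Subset n) λ S → ∀ i → i ∈ S ⇔ P i
¬¬-subset {zero}  P = pure ([] , λ ())
¬¬-subset {suc n} P = do
  P0? ← ¬¬-excluded-middle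
  S , S⇔P ← ¬¬-subset (P ∘ suc)
  pure (extend P0? S S⇔P)
  where
  extend : Dec (P zero) → (S : Subset n) → (∀ i → i ∈ S ⇔ P (suc i)) →
           Σ (Subset (suc n)) λ S′ → ∀ i → i ∈ S′ ⇔ P i
  extend P0? S S⇔P = does P0? ∷ S , λ
    { zero    → zero∈⇔ P0?
    ; (suc i) → mk⇔ (λ { (there i∈S) → Equivalence.to (S⇔P i) i∈S }) (there ∘ Equivalence.from (S⇔P i)) }
    where
    zero∈⇔ : (P0? : Dec (P zero)) → zero ∈ does P0? ∷ S ⇔ P zero
    zero∈⇔ (yes P0) = mk⇔ (λ _ → P0) (λ _ → here)
    zero∈⇔ (no ¬P0) = mk⇔ (λ ()) (⊥-elim ∘ ¬P0)

module _ {n} (P : Pred (Subset n) 0ℓ) where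

  Maximal : Pred (Subset n) 0ℓ
  Maximal M = P M × (∀ T → M ⊆ T → P T → T ≡ M)

  MaximalAbove : Pred (Subset n) 0ℓ
  MaximalAbove S = Σ (Subset n) λ M → S ⊆ M × Maximal M

  ¬¬-maximalAbove : ∀ {S} → P S → ¬ ¬ MaximalAbove S
  ¬¬-maximalAbove {S} = grow (⊃-wellFounded S)
    where
    ProperExtension : Subset n → Set
    ProperExtension S = Σ (Subset n) λ T → S ⊂ T × P T

    no-extension⇒maximal : ∀ {S} → ¬ ProperExtension S → ∀ T → S ⊆ T → P T → T ≡ S
    no-extension⇒maximal {S} ∄T T S⊆T PT = ⊆-antisym T⊆S S⊆T
      where
      T⊆S : T ⊆ S
      T⊆S {x} x∈T = decidable-stable (x ∈? S) λ x∉S → ∄T (T , (S⊆T , x , x∈T , x∉S) , PT)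

    grow : ∀ {S} → Acc _⊃_ S → P S → ¬ ¬ MaximalAbove S
    grow {S} (acc rec) PS = do
      yes (T , S⊂T , PT) ← ¬¬-excluded-middle {A = ProperExtension S}
        where no ∄T → pure {A = MaximalAbove S} (S , ⊆-refl , PS , no-extension⇒maximal ∄T)
      M , T⊆M , M-maximal ← grow (rec S⊂T) PT
      pure {A = MaximalAbove S} (M , ⊆-trans (proj₁ S⊂T) T⊆M , M-maximal)

module _ {n} {R : Rel (Fin n) 0ℓ} (acyclic : ∀ i → ¬ TransClosure R i i) where

  ¬¬-minimal-ancestor : ∀ v → ¬ ¬ ∃ λ r → (∀ u → ¬ R u r) × Star R r v
  ¬¬-minimal-ancestor v = do
    A , A⇔R⁺ ← ¬¬-subset (λ u → TransClosure R u v)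
    descend A⇔R⁺ (⊂-wellFounded A)
    where
    descend : ∀ {v A} → (∀ u → u ∈ A ⇔ TransClosure R u v) → Acc _⊂_ A →
              ¬ ¬ ∃ λ r → (∀ u → ¬ R u r) × Star R r v
    descend {v} {A} A⇔R⁺ (acc rec) = do
      yes (p , Rpv) ← ¬¬-excluded-middle {A = ∃ λ p → R p v}
        where no ∄p → pure (v , (λ u Ruv → ∄p (u , Ruv)) , ε)
      B , B⇔R⁺ ← ¬¬-subset (λ u → TransClosure R u p)
      let B⊂A : B ⊂ A
          B⊂A = (λ {u} u∈B → Equivalence.from (A⇔R⁺ u) (Equivalence.to (B⇔R⁺ u) u∈B ∷ʳ Rpv))
              , p , Equivalence.from (A⇔R⁺ p) [ Rpv ] , acyclic p ∘ Equivalence.to (B⇔R⁺ p)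
      r , r-minimal , r→p ← descend B⇔R⁺ (rec B⊂A)
      pure (r , r-minimal , r→p ◅◅ Rpv ◅ ε)

𝟙 : Bool → ℕ
𝟙 b = if b then 1 else 0

sumFin≡∑ : ∀ {n} (f : Fin n → ℕ) → sumFin f ≡ ∑[ i < n ] f i
sumFin≡∑ {zero}  f = refl
sumFin≡∑ {suc n} f = cong (f zero +_) (sumFin≡∑ (f ∘ suc))

countFin≡∑ : ∀ {n} (p : Fin n → Bool) → countFin p ≡ ∑[ i < n ] 𝟙 (p i)
countFin≡∑ {zero}  p = refl
countFin≡∑ {suc n} p = cong (𝟙 (p zero) +_) (countFin≡∑ (p ∘ suc))

countFin-none : ∀ {n} (p : Fin n → Bool) → (∀ i → p i ≡ false) → countFin p ≡ 0
countFin-none {zero}  p none = refl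
countFin-none {suc n} p none rewrite none zero = countFin-none (p ∘ suc) (none ∘ suc)

countFin-cong : ∀ {n} {p q : Fin n → Bool} → (∀ i → p i ≡ q i) → countFin p ≡ countFin q
countFin-cong {zero}  p≗q = refl
countFin-cong {suc n} p≗q = cong₂ _+_ (cong 𝟙 (p≗q zero)) (countFin-cong (p≗q ∘ suc))

countFin-unique : ∀ {n} (p : Fin n → Bool) (x : Fin n) → p x ≡ true →
                  (∀ i → p i ≡ true → i ≡ x) → countFin p ≡ 1
countFin-unique {suc n} p x px unique = begin
  countFin p                               ≡⟨ countFin≡∑ p ⟩
  ∑[ i < _ ] 𝟙 (p i)                       ≡⟨ sum-remove (𝟙 ∘ p) ⟩
  𝟙 (p x) + ∑[ i < n ] 𝟙 (p (punchIn x i)) ≡⟨ cong (𝟙 (p x) +_) (countFin≡∑ (p ∘ punchIn x)) ⟨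
  𝟙 (p x) + countFin (p ∘ punchIn x)       ≡⟨ cong₂ _+_ (cong 𝟙 px) (countFin-none (p ∘ punchIn x) others) ⟩
  1                                        ∎
  where
  others : ∀ i → p (punchIn x i) ≡ false
  others i = ¬-not (punchInᵢ≢i x i ∘ unique (punchIn x i))

sum-update : ∀ {n} (f g : Fin n → ℕ) (y : Fin n) → (∀ j → j ≢ y → f j ≡ g j) →
             ∑[ j < n ] g j + f y ≡ ∑[ j < n ] f j + g y
sum-update {suc n} f g y agree = begin
  ∑[ j < _ ] g j + f y                              ≡⟨ cong (_+ f y) (sum-remove g) ⟩
  g y + ∑[ j < n ] g (punchIn y j) + f y            ≡⟨ cong (λ s → g y + s + f y) (sum-cong-≗ rest) ⟨
  g y + ∑[ j < n ] f (punchIn y j) + f y            ≡⟨ xy∙z≈zy∙x (g y) _ (f y) ⟩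
  f y + ∑[ j < n ] f (punchIn y j) + g y            ≡⟨ cong (_+ g y) (sum-remove f) ⟨
  ∑[ j < _ ] f j + g y                              ∎
  where
  rest : ∀ j → f (punchIn y j) ≡ g (punchIn y j)
  rest j = agree (punchIn y j) (punchInᵢ≢i y j)

anyFin-true⇔ : ∀ {n} (p : Fin n → Bool) → anyFin p ≡ true ⇔ ∃ λ i → p i ≡ true
anyFin-true⇔ {zero}  p = mk⇔ (λ ()) (λ ())
anyFin-true⇔ {suc n} p with p zero in p0
... | true  = mk⇔ (λ _ → zero , p0) (λ _ → refl)
... | false = mk⇔ (Product.map suc id ∘ Equivalence.to IH) from
  where
  IH = anyFin-true⇔ (p ∘ suc)
  from : (∃ λ i → p i ≡ true) → anyFin (p ∘ suc) ≡ true
  from (zero  , p0≡true) = contradiction (trans (sym p0) p0≡true) λ ()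
  from (suc i , pi≡true) = Equivalence.from IH (i , pi≡true)

record Enumeration {n} (p : Fin n → Bool) (m : ℕ) : Set where
  field
    elem      : Fin m → Fin n
    injective : Injective _≡_ _≡_ elem
    sound     : ∀ k → p (elem k) ≡ true
    complete  : ∀ i → p i ≡ true → ∃ λ k → elem k ≡ i

enumerate : ∀ {n} (p : Fin n → Bool) → Enumeration p (countFin p)
enumerate {zero}  p = record { elem = λ () ; injective = λ {k} → case k of λ () ; sound = λ () ; complete = λ () }
enumerate {suc n} p = extend (p zero) refl (enumerate (p ∘ suc))
  where
  extend : ∀ {m} b → p zero ≡ b → Enumeration (p ∘ suc) m → Enumeration p (𝟙 b + m)
  extend true p0 e = record { elem = elem′ ; injective = injective′ ; sound = sound′ ; complete = complete′ }
    where
    open Enumeration e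
    elem′ : Fin (suc _) → Fin (suc n)
    elem′ zero    = zero
    elem′ (suc k) = suc (elem k)
    injective′ : Injective _≡_ _≡_ elem′
    injective′ {zero}  {zero}  _  = refl
    injective′ {zero}  {suc _} ()
    injective′ {suc _} {zero}  ()
    injective′ {suc k} {suc l} eq = cong suc (injective (suc-injective eq))
    sound′ : ∀ k → p (elem′ k) ≡ true
    sound′ zero    = p0
    sound′ (suc k) = sound k
    complete′ : ∀ i → p i ≡ true → ∃ λ k → elem′ k ≡ i
    complete′ zero    _  = zero , refl
    complete′ (suc i) pi = Product.map suc (cong suc) (complete i pi)
  extend false p0 e = record { elem = suc ∘ elem ; injective = injective ∘ suc-injective
                             ; sound = sound ; complete = complete′ }
    where
    open Enumeration e
    complete′ : ∀ i → p i ≡ true → ∃ λ k → suc (elem k) ≡ i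
    complete′ zero    p0≡true = contradiction (trans (sym p0) p0≡true) λ ()
    complete′ (suc i) pi      = Product.map₂ (cong suc) (complete i pi)

countFin-≤ : ∀ {n m} (p : Fin n → Bool) (g : Fin n → Fin m) →
             (∀ {i j} → p i ≡ true → p j ≡ true → g i ≡ g j → i ≡ j) → countFin p ≤ m
countFin-≤ p g g-injective = injective⇒≤ (injective ∘ g-injective (sound _) (sound _))
  where open Enumeration (enumerate p)

≤-countFin : ∀ {n m} (p : Fin n → Bool) (g : Fin n → Fin m) →
             (∀ k → ∃ λ i → p i ≡ true × g i ≡ k) → m ≤ countFin p
≤-countFin p g g-onto = injective⇒≤ {f = position} λ {k} {l} eq → begin
  k                        ≡⟨ proj₂ (proj₂ (g-onto k)) ⟨
  g (proj₁ (g-onto k))     ≡⟨ cong g (elem-position k) ⟨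
  g (elem (position k))    ≡⟨ cong (g ∘ elem) eq ⟩
  g (elem (position l))    ≡⟨ cong g (elem-position l) ⟩
  g (proj₁ (g-onto l))     ≡⟨ proj₂ (proj₂ (g-onto l)) ⟩
  l                        ∎
  where
  open Enumeration (enumerate p)
  found : ∀ k → ∃ λ j → elem j ≡ proj₁ (g-onto k)
  found k = complete _ (proj₁ (proj₂ (g-onto k)))
  position : Fin _ → Fin (countFin p)
  position k = proj₁ (found k)
  elem-position : ∀ k → elem (position k) ≡ proj₁ (g-onto k)
  elem-position k = proj₂ (found k)

module _ {n} (F : Digraph n) where

  indegree : Fin n → ℕ
  indegree j = countFin (λ i → F i j)

  numArcs≡∑indegree : numArcs F ≡ ∑[ j < n ] indegree j
  numArcs≡∑indegree = begin
    sumFin (λ i → countFin (F i))    ≡⟨ sumFin≡∑ (λ i → countFin (F i)) ⟩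
    ∑[ i < n ] countFin (F i)        ≡⟨ sum-cong-≗ (λ i → countFin≡∑ (F i)) ⟩
    ∑[ i < n ] ∑[ j < n ] 𝟙 (F i j)  ≡⟨ ∑-comm (λ i j → 𝟙 (F i j)) ⟩
    ∑[ j < n ] ∑[ i < n ] 𝟙 (F i j)  ≡⟨ sum-cong-≗ (λ j → countFin≡∑ (λ i → F i j)) ⟨
    ∑[ j < n ] indegree j            ∎

  IsRoot : Fin n → Set
  IsRoot r = ∀ i → ¬ Arc F i r

  root? : Fin n → Bool
  root? j = not (anyFin (λ i → F i j))

  IsRoot⇒root? : ∀ {r} → IsRoot r → root? r ≡ true
  IsRoot⇒root? {r} root with anyFin (λ i → F i r) in any
  ... | true  = ⊥-elim (uncurry root (Equivalence.to (anyFin-true⇔ _) any))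
  ... | false = refl

  root?⇒IsRoot : ∀ {r} → root? r ≡ true → IsRoot r
  root?⇒IsRoot {r} is-root i Fir with anyFin (λ i → F i r) in any
  ... | false = contradiction (trans (sym any) (Equivalence.from (anyFin-true⇔ _) (i , Fir))) λ ()

  reach-root : ∀ {u r} → IsRoot r → Reach F u r → u ≡ r
  reach-root root ε = refl
  reach-root root (Fuw ◅ w→r) with reach-root root w→r
  ... | refl = ⊥-elim (root _ Fuw)

  indegree-root : ∀ {r} → IsRoot r → indegree r ≡ 0
  indegree-root root = countFin-none _ (λ i → ¬-not (root i))

  indegree-parent : (∀ i i′ j → Arc F i j → Arc F i′ j → i ≡ i′) →
                    ∀ {p j} → Arc F p j → indegree j ≡ 1
  indegree-parent unique-parent {p} {j} Fpj =
    countFin-unique _ p Fpj (λ i Fij → unique-parent i p j Fij Fpj)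

TransClosure⇒Star : ∀ {n} {R : Rel (Fin n) 0ℓ} {u v} → TransClosure R u v → Star R u v
TransClosure⇒Star [ Ruv ]      = Ruv ◅ ε
TransClosure⇒Star (Ruw ∷ w→v) = Ruw ◅ TransClosure⇒Star w→v

reparent : ∀ {n} → Digraph n → Fin n → Fin n → Digraph n
reparent F x y i j = if does (j ≟ y) then does (i ≟ x) else F i j

module _ {n} (F : Digraph n) (x y : Fin n) where

  private
    F′ = reparent F x y

  reparent-arc : ∀ i j → Arc F′ i j → (i ≡ x × j ≡ y) ⊎ (j ≢ y × Arc F i j)
  reparent-arc i j F′ij with j ≟ y | i ≟ x
  ... | yes j≡y | yes i≡x = inj₁ (i≡x , j≡y)
  reparent-arc i j () | yes _ | no _
  ... | no j≢y  | _       = inj₂ (j≢y , F′ij)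

  reparent-new : Arc F′ x y
  reparent-new = trans (cong (λ b → if b then does (x ≟ x) else F x y) (dec-true (y ≟ y) refl))
                       (dec-true (x ≟ x) refl)

  reparent-other : ∀ {i j} → j ≢ y → F′ i j ≡ F i j
  reparent-other {i} {j} j≢y = cong (λ b → if b then does (i ≟ x) else F i j) (dec-false (j ≟ y) j≢y)

  reparent-numArcs : numArcs F′ + indegree F y ≡ numArcs F + 1
  reparent-numArcs = begin
    numArcs F′ + indegree F y                   ≡⟨ cong (_+ indegree F y) (numArcs≡∑indegree F′) ⟩
    ∑[ j < n ] indegree F′ j + indegree F y     ≡⟨ sum-update (indegree F) (indegree F′) y unchanged ⟩
    ∑[ j < n ] indegree F j + indegree F′ y     ≡⟨ cong₂ _+_ (sym (numArcs≡∑indegree F)) indegree-y ⟩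
    numArcs F + 1                               ∎
    where
    unchanged : ∀ j → j ≢ y → indegree F j ≡ indegree F′ j
    unchanged j j≢y = countFin-cong (λ i → sym (reparent-other {i} j≢y))
    indegree-y : indegree F′ y ≡ 1
    indegree-y = countFin-unique _ x reparent-new only-x
      where
      only-x : ∀ i → Arc F′ i y → i ≡ x
      only-x i F′iy with reparent-arc i y F′iy
      ... | inj₁ (i≡x , _) = i≡x
      ... | inj₂ (y≢y , _) = contradiction refl y≢y

  reparent-reach-from-y : ∀ {u v} → Reach F y u → Reach F′ u v → Reach F y v
  reparent-reach-from-y y→u ε = y→u
  reparent-reach-from-y {u} y→u (_◅_ {j = w} F′uw w→v) with reparent-arc u w F′uw
  ... | inj₁ (_ , refl) = reparent-reach-from-y ε w→v
  ... | inj₂ (_ , Fuw)  = reparent-reach-from-y (y→u ◅◅ Fuw ◅ ε) w→v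

  reparent-path : ∀ {u v} → TransClosure (Arc F′) u v →
                  TransClosure (Arc F) u v ⊎ (Reach F′ u x × Reach F′ y v)
  reparent-path {u} {v} [ F′uv ] with reparent-arc u v F′uv
  ... | inj₁ (refl , refl) = inj₂ (ε , ε)
  ... | inj₂ (_ , Fuv)     = inj₁ [ Fuv ]
  reparent-path {u} (_∷_ {y = w} F′uw w→v) with reparent-arc u w F′uw | reparent-path w→v
  ... | inj₁ (refl , refl) | _                = inj₂ (ε , TransClosure⇒Star w→v)
  ... | inj₂ (_ , Fuw)     | inj₁ F-w→v       = inj₁ (Fuw ∷ F-w→v)
  ... | inj₂ (_ , Fuw)     | inj₂ (w→x , y→v) = inj₂ (F′uw ◅ w→x , y→v)

  reparent-forest : ∀ {G} → IsSpanningDivergingForest G F → Arc G x y → ¬ Reach F y x →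
                    IsSpanningDivergingForest G F′
  reparent-forest {G} (F⊆G , acyclic , unique-parent) Gxy y↛x = F′⊆G , acyclic′ , unique-parent′
    where
    F′⊆G : SubgraphOf F′ G
    F′⊆G i j F′ij with reparent-arc i j F′ij
    ... | inj₁ (refl , refl) = Gxy
    ... | inj₂ (_ , Fij)     = F⊆G i j Fij

    acyclic′ : ∀ i → ¬ TransClosure (Arc F′) i i
    acyclic′ i cycle with reparent-path cycle
    ... | inj₁ F-cycle      = acyclic i F-cycle
    ... | inj₂ (i→x , y→i) = y↛x (reparent-reach-from-y ε (y→i ◅◅ i→x))

    unique-parent′ : ∀ i i′ j → Arc F′ i j → Arc F′ i′ j → i ≡ i′
    unique-parent′ i i′ j F′ij F′i′j with reparent-arc i j F′ij | reparent-arc i′ j F′i′j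
    ... | inj₁ (i≡x , _)  | inj₁ (i′≡x , _) = trans i≡x (sym i′≡x)
    ... | inj₁ (_ , j≡y)  | inj₂ (j≢y , _)  = contradiction j≡y j≢y
    ... | inj₂ (j≢y , _)  | inj₁ (_ , j≡y)  = contradiction j≡y j≢y
    ... | inj₂ (_ , Fij)  | inj₂ (_ , Fi′j) = unique-parent i i′ j Fij Fi′j

  reparent-root : ∀ {r} → IsRoot F r → r ≢ y → IsRoot F′ r
  reparent-root {r} root r≢y i F′ir with reparent-arc i r F′ir
  ... | inj₁ (_ , r≡y) = r≢y r≡y
  ... | inj₂ (_ , Fir) = root i Fir

  reparent-descendants : ∀ {r v} → ¬ Reach F r x → r ≢ y → Reach F′ r v → Reach F r v × v ≢ y
  reparent-descendants {r} r↛x = descend ε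
    where
    descend : ∀ {u v} → Reach F r u → u ≢ y → Reach F′ u v → Reach F r v × v ≢ y
    descend r→u u≢y ε = r→u , u≢y
    descend {u} r→u u≢y (_◅_ {j = w} F′uw w→v) with reparent-arc u w F′uw
    ... | inj₁ (refl , _) = contradiction r→u r↛x
    ... | inj₂ (w≢y , Fuw) = descend (r→u ◅◅ Fuw ◅ ε) w≢y w→v

module _ {n} {G : Digraph n} where

  reparent-maximum : ∀ {F r x z} → IsMaximumOutForest G F → IsRoot F r → ¬ Reach F r x → Reach F r z →
                     Arc G x z → IsMaximumOutForest G (reparent F x z) × IsRoot (reparent F x z) r
                     × ¬ Reach (reparent F x z) r z
  reparent-maximum {F} {r} {x} {z} (forest , maximum) root r↛x r→z Gxz =
    case any? (λ i → F i z Bool.≟ true) of λ where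
      (no ∄parent)    → contradiction (maximum F′ forest′) (<⇒≱ (gains-arc λ i Fiz → ∄parent (i , Fiz)))
      (yes (p , Fpz)) → (forest′ , λ F″ forest″ → ≤-trans (maximum F″ forest″) (≤-reflexive (keeps-arcs Fpz)))
                      , reparent-root F x z root (r≢z Fpz)
                      , λ r→′z → proj₂ (reparent-descendants F x z r↛x (r≢z Fpz) r→′z) refl
    where
    F′ = reparent F x z

    forest′ : IsSpanningDivergingForest G F′
    forest′ = reparent-forest F x z forest Gxz (r↛x ∘ (r→z ◅◅_))

    gains-arc : IsRoot F z → numArcs F < numArcs F′
    gains-arc root-z = ≤-reflexive (begin
      suc (numArcs F)           ≡⟨ +-comm 1 (numArcs F) ⟩
      numArcs F + 1             ≡⟨ reparent-numArcs F x z ⟨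
      numArcs F′ + indegree F z ≡⟨ cong (numArcs F′ +_) (indegree-root F root-z) ⟩
      numArcs F′ + 0            ≡⟨ +-identityʳ (numArcs F′) ⟩
      numArcs F′                ∎)

    keeps-arcs : ∀ {p} → Arc F p z → numArcs F ≡ numArcs F′
    keeps-arcs Fpz = +-cancelʳ-≡ _ _ _ (begin
      numArcs F + 1             ≡⟨ reparent-numArcs F x z ⟨
      numArcs F′ + indegree F z ≡⟨ cong (numArcs F′ +_) (indegree-parent F (proj₂ (proj₂ forest)) Fpz) ⟩
      numArcs F′ + 1            ∎)

    r≢z : ∀ {p} → Arc F p z → r ≢ z
    r≢z Fpz refl = root _ Fpz

  maximum-forest-¬descendant⇒¬ancestor : ∀ {F r x} → IsMaximumOutForest G F → IsRoot F r → ¬ Reach F r x →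
                               ¬ Reach G x r
  maximum-forest-¬descendant⇒¬ancestor max root r↛x ε = r↛x ε
  maximum-forest-¬descendant⇒¬ancestor {F} {r} max root r↛x (_◅_ {j = z} Gxz z→r) = ¬¬-excluded-middle λ
    { (no r↛z)  → maximum-forest-¬descendant⇒¬ancestor max root r↛z z→r
    ; (yes r→z) → let max′ , root′ , r↛′z = reparent-maximum max root r↛x r→z Gxz
                  in maximum-forest-¬descendant⇒¬ancestor max′ root′ r↛′z z→r }

  maximum-forest-roots-unreachable : ∀ {F r r′} → IsMaximumOutForest G F → IsRoot F r → IsRoot F r′ →
                                     Reach G r r′ → r ≡ r′
  maximum-forest-roots-unreachable {F} {r} {r′} max root root′ r→r′ =
    decidable-stable (r ≟ r′) λ r≢r′ →
      maximum-forest-¬descendant⇒¬ancestor max root′ (r≢r′ ∘ sym ∘ reach-root F root) r→r′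

¬¬-unilateral-component : ∀ {n} (G : Digraph n) v →
                          ¬ ¬ Σ (Subset n) λ S → IsUnilateralComponent G S × v ∈ S
¬¬-unilateral-component G v = do
  M , ⁅v⁆⊆M , M-connected , M-maximal ← ¬¬-maximalAbove (UnilaterallyConnected G) singleton-connected
  let v∈M = ⁅v⁆⊆M (x∈⁅x⁆ v)
  pure (M , ((v , v∈M) , M-connected , M-maximal) , v∈M)
  where
  singleton-connected : UnilaterallyConnected G ⁅ v ⁆
  singleton-connected i j i∈⁅v⁆ j∈⁅v⁆
    rewrite x∈⁅y⁆⇒x≡y v i∈⁅v⁆ | x∈⁅y⁆⇒x≡y v j∈⁅v⁆ = inj₁ ε

module _ {n} {G F : Digraph n} where

  weak-classes≤roots : IsSpanningDivergingForest G F →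
                       ∀ {w} → NumClasses (WeaklyConnected G) w → w ≤ numRoots F
  weak-classes≤roots (F⊆G , acyclic , _) {w} (c , c-onto , c⇔) =
    decidable-stable (w ≤? numRoots F) (≤-countFin (root? F) c <$> ¬¬-Π root-in-class)
    where
    root-in-class : ∀ k → ¬ ¬ ∃ λ r → root? F r ≡ true × c r ≡ k
    root-in-class k = do
      let v , cv≡k = c-onto k
      r , root , r→v ← ¬¬-minimal-ancestor acyclic v
      pure (r , IsRoot⇒root? F root
              , trans (Equivalence.from (c⇔ r v) (Star.map (λ {i j} → fwd ∘ F⊆G i j) r→v)) (cv≡k refl))

  roots≤strong-classes : IsMaximumOutForest G F →
                         ∀ {s} → NumClasses (StronglyConnected G) s → numRoots F ≤ s
  roots≤strong-classes max (c , _ , c⇔) = countFin-≤ (root? F) c λ {i j} ri rj ci≡cj →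
    maximum-forest-roots-unreachable max (root?⇒IsRoot F ri) (root?⇒IsRoot F rj)
      (proj₁ (Equivalence.to (c⇔ i j) ci≡cj))

  unilateral-roots-equal : IsMaximumOutForest G F → ∀ {S i j} → UnilaterallyConnected G S →
                           i ∈ S → j ∈ S → IsRoot F i → IsRoot F j → i ≡ j
  unilateral-roots-equal max {i = i} {j} connected i∈S j∈S root-i root-j with connected i j i∈S j∈S
  ... | inj₁ i→j = maximum-forest-roots-unreachable max root-i root-j (Star.map proj₁ i→j)
  ... | inj₂ j→i = sym (maximum-forest-roots-unreachable max root-j root-i (Star.map proj₁ j→i))

  roots≤unilateral-components : IsMaximumOutForest G F →
                                ∀ {u} → NumUnilateralComponents G u → numRoots F ≤ u
  -- L need not be duplicate-free for this bound.
  roots≤unilateral-components max (L , _ , L⇔ , refl) =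
    decidable-stable (_ ≤? _) (count <$> ¬¬-Π (¬¬-unilateral-component G))
    where
    count : (∀ v → Σ (Subset n) λ S → IsUnilateralComponent G S × v ∈ S) → numRoots F ≤ length L
    count component = countFin-≤ (root? F) position position-injective
      where
      S : Fin n → Subset n
      S v = proj₁ (component v)
      v∈S : ∀ v → v ∈ S v
      v∈S v = proj₂ (proj₂ (component v))
      S-connected : ∀ v → UnilaterallyConnected G (S v)
      S-connected v = proj₁ (proj₂ (proj₁ (proj₂ (component v))))
      S∈L : ∀ v → S v ∈L L
      S∈L v = Equivalence.from (L⇔ (S v)) (proj₁ (proj₂ (component v)))
      position : Fin n → Fin (length L)
      position v = Any.index (S∈L v)
      position-injective : ∀ {i j} → root? F i ≡ true → root? F j ≡ true → position i ≡ position j → i ≡ j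
      position-injective {i} {j} ri rj same =
        unilateral-roots-equal max (S-connected i) (v∈S i) j∈Si (root?⇒IsRoot F ri) (root?⇒IsRoot F rj)
        where
        j∈Si : j ∈ S i
        j∈Si = subst (j ∈_) (sym (index-injective (≡.setoid _) (S∈L i) (S∈L j) same)) (v∈S j)

proposition8 : (n : ℕ) (G : Digraph n) → Loopless G →
    (F : Digraph n) → IsMaximumOutForest G F →
    ((w : ℕ) → NumClasses (WeaklyConnected G) w → w ≤ numRoots F)
    × ((s : ℕ) → NumClasses (StronglyConnected G) s → numRoots F ≤ s)
    × ((u : ℕ) → NumUnilateralComponents G u → numRoots F ≤ u)
proposition8 n G _ F max =
    (λ _ → weak-classes≤roots (proj₁ max))
  , (λ _ → roots≤strong-classes max)
  , (λ _ → roots≤unilateral-components max)
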